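{- If $m\notin \mathrm{dom}(p)$ and $t\to_{p(m\mapsto \mathsf{0})} u$ and $t\to_{p(m\mapsto \mathsf{1})} u$ then $t\to_p u$.
   Context: A condition $p$ is (the graph of) a finite partial function from $\mathbb{N}$ to $\{\mathsf{0},\mathsf{1}\}$; for $m\notin\mathrm{dom}(p)$, $p(m\mapsto b)$ denotes $p\cup\{(m,b)\}$. The term language is that of Martin-Löf type theory with $\mathsf{N},\mathsf{N}_0,\mathsf{N}_1,\mathsf{N}_2$, $\Pi$, $\Sigma$, a universe, recursors $\mathsf{rec}_{\mathsf{N}_0},\mathsf{rec}_{\mathsf{N}_1},\mathsf{rec}_{\mathsf{N}_2},\mathsf{rec}_{\mathsf{N}}$, extended with a constant $\mathsf{f}$ (a generic point $\mathsf{N}\to\mathsf{N}_2$); $\overline{n}$ denotes $\mathsf{S}^n\,\mathsf{0}$. Evaluation contexts are $\mathbb{E} ::= [\;] \mid \mathbb{E}\,u \mid \mathbb{E}.1 \mid \mathbb{E}.2 \mid \mathsf{S}\,\mathbb{E} \mid \mathsf{f}\,\mathbb{E} \mid \mathsf{rec}_{\mathsf{N}_0}(\lambda x.C)\,\mathbb{E} \mid \mathsf{rec}_{\mathsf{N}_1}(\lambda x.C)\,a\,\mathbb{E} \mid \mathsf{rec}_{\mathsf{N}_2}(\lambda x.C)\,a_0\,a_1\,\mathbb{E} \mid \mathsf{rec}_{\mathsf{N}}(\lambda x.C)\,c_z\,g\,\mathbb{E}$. The unannotated one-step reduction $e\to e'$ consists of the $\beta$-rule $(\lambda x.t)\,a\to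 t[a/x]$, the projection rules $(u,v).1\to u$, $(u,v).2\to v$, and the $\iota$-rules for the recursors ($\mathsf{rec}_{\mathsf{N}_1}(\lambda x.C)\,c\,\mathsf{0}\to c$; $\mathsf{rec}_{\mathsf{N}_2}(\lambda x.C)\,c_0\,c_1\,\mathsf{0}\to c_0$; $\mathsf{rec}_{\mathsf{N}_2}(\lambda x.C)\,c_0\,c_1\,\mathsf{1}\to c_1$; $\mathsf{rec}_{\mathsf{N}}(\lambda x.C)\,c_z\,g\,\mathsf{0}\to c_z$; $\mathsf{rec}_{\mathsf{N}}(\lambda x.C)\,c_z\,g\,(\mathsf{S}\,\overline{k})\to g\,\overline{k}\,(\mathsf{rec}_{\mathsf{N}}(\lambda x.C)\,c_z\,g\,\overline{k})$). The reduction $t\to_p u$ at condition $p$ is defined inductively: if $e\to e'$ then $e\to_p e'$; if $k\in\mathrm{dom}(p)$ then $\mathsf{f}\,\overline{k}\to_p p(k)$; and if $e\to_p e'$ then $\mathbb{E}[e]\to_p\mathbb{E}[e']$. -}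

module Defs where

open import Data.Nat using (ℕ; zero; suc; _≤_; _⊔_)
open import Data.Fin using (Fin) renaming (zero to fz; suc to fs)
open import Data.Bool using (Bool; true; false)
open import Data.Maybe using (Maybe; just; nothing)
open import Relation.Binary.PropositionalEquality using (_≡_)
open import Relation.Nullary using (yes; no)
import Data.Nat as Nat

-- Well-scoped terms (de Bruijn) of MLTT with N, N0, N1, N2, Π, Σ, U,
-- the recursors, and the generic-point constant f.
-- The constants 𝟘 and 𝟙 are the (overloaded) canonical elements
-- 0 (of N, N1, N2) and 1 (of N2), as in the paper's syntax.

data Term (n : ℕ) : Set where
  var   : Fin n → Term n
  `N `N₀ `N₁ `N₂ `U : Term n
  `Π `Σ : Term n → Term (suc n) → Term n
  lam   : Term (suc n) → Term n
  app   : Term n → Term n → Term n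
  pair  : Term n → Term n → Term n
  fst snd : Term n → Term n
  𝟘 𝟙   : Term n
  S     : Term n → Term n
  `f    : Term n
  recN₀ : Term (suc n) → Term n → Term n
  recN₁ : Term (suc n) → Term n → Term n → Term n
  recN₂ : Term (suc n) → Term n → Term n → Term n → Term n
  recN  : Term (suc n) → Term n → Term n → Term n → Term n

Ren : ℕ → ℕ → Set
Ren m n = Fin m → Fin n

liftR : ∀ {m n} → Ren m n → Ren (suc m) (suc n)
liftR ρ fz = fz
liftR ρ (fs i) = fs (ρ i)

ren : ∀ {m n} → Ren m n → Term m → Term n
ren ρ (var i) = var (ρ i)
ren ρ `N = `N
ren ρ `N₀ = `N₀
ren ρ `N₁ = `N₁
ren ρ `N₂ = `N₂
ren ρ `U = `U
ren ρ (`Π A B) = `Π (ren ρ A) (ren (liftR ρ) B)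
ren ρ (`Σ A B) = `Σ (ren ρ A) (ren (liftR ρ) B)
ren ρ (lam t) = lam (ren (liftR ρ) t)
ren ρ (app t u) = app (ren ρ t) (ren ρ u)
ren ρ (pair t u) = pair (ren ρ t) (ren ρ u)
ren ρ (fst t) = fst (ren ρ t)
ren ρ (snd t) = snd (ren ρ t)
ren ρ 𝟘 = 𝟘
ren ρ 𝟙 = 𝟙
ren ρ (S t) = S (ren ρ t)
ren ρ `f = `f
ren ρ (recN₀ C e) = recN₀ (ren (liftR ρ) C) (ren ρ e)
ren ρ (recN₁ C a e) = recN₁ (ren (liftR ρ) C) (ren ρ a) (ren ρ e)
ren ρ (recN₂ C a b e) = recN₂ (ren (liftR ρ) C) (ren ρ a) (ren ρ b) (ren ρ e)
ren ρ (recN C z g e) = recN (ren (liftR ρ) C) (ren ρ z) (ren ρ g) (ren ρ e)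

Sub : ℕ → ℕ → Set
Sub m n = Fin m → Term n

liftS : ∀ {m n} → Sub m n → Sub (suc m) (suc n)
liftS σ fz = var fz
liftS σ (fs i) = ren fs (σ i)

sub : ∀ {m n} → Sub m n → Term m → Term n
sub σ (var i) = σ i
sub σ `N = `N
sub σ `N₀ = `N₀
sub σ `N₁ = `N₁
sub σ `N₂ = `N₂
sub σ `U = `U
sub σ (`Π A B) = `Π (sub σ A) (sub (liftS σ) B)
sub σ (`Σ A B) = `Σ (sub σ A) (sub (liftS σ) B)
sub σ (lam t) = lam (sub (liftS σ) t)
sub σ (app t u) = app (sub σ t) (sub σ u)
sub σ (pair t u) = pair (sub σ t) (sub σ u)
sub σ (fst t) = fst (sub σ t)
sub σ (snd t) = snd (sub σ t)
sub σ 𝟘 = 𝟘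
sub σ 𝟙 = 𝟙
sub σ (S t) = S (sub σ t)
sub σ `f = `f
sub σ (recN₀ C e) = recN₀ (sub (liftS σ) C) (sub σ e)
sub σ (recN₁ C a e) = recN₁ (sub (liftS σ) C) (sub σ a) (sub σ e)
sub σ (recN₂ C a b e) = recN₂ (sub (liftS σ) C) (sub σ a) (sub σ b) (sub σ e)
sub σ (recN C z g e) = recN (sub (liftS σ) C) (sub σ z) (sub σ g) (sub σ e)

_[_] : ∀ {n} → Term (suc n) → Term n → Term n
t [ a ] = sub (λ { fz → a ; (fs i) → var i }) t

num : ∀ {n} → ℕ → Term n
num zero = 𝟘
num (suc k) = S (num k)

bit : ∀ {n} → Bool → Term n
bit false = 𝟘
bit true = 𝟙

data _⟶_ {n : ℕ} : Term n → Term n → Set where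
  β      : ∀ t a → app (lam t) a ⟶ (t [ a ])
  π₁     : ∀ u v → fst (pair u v) ⟶ u
  π₂     : ∀ u v → snd (pair u v) ⟶ v
  ιN₁    : ∀ C c → recN₁ C c 𝟘 ⟶ c
  ιN₂-0  : ∀ C c₀ c₁ → recN₂ C c₀ c₁ 𝟘 ⟶ c₀
  ιN₂-1  : ∀ C c₀ c₁ → recN₂ C c₀ c₁ 𝟙 ⟶ c₁
  ιN-0   : ∀ C cz g → recN C cz g 𝟘 ⟶ cz
  ιN-S   : ∀ C cz g k →
           recN C cz g (S (num k)) ⟶ app (app g (num k)) (recN C cz g (num k))

data ECtx (n : ℕ) : Set where
  hole  : ECtx n
  appL  : ECtx n → Term n → ECtx n
  fstE  : ECtx n → ECtx n
  sndE  : ECtx n → ECtx n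
  SE    : ECtx n → ECtx n
  fE    : ECtx n → ECtx n
  recN₀E : Term (suc n) → ECtx n → ECtx n
  recN₁E : Term (suc n) → Term n → ECtx n → ECtx n
  recN₂E : Term (suc n) → Term n → Term n → ECtx n → ECtx n
  recNE  : Term (suc n) → Term n → Term n → ECtx n → ECtx n

plug : ∀ {n} → ECtx n → Term n → Term n
plug hole e = e
plug (appL E u) e = app (plug E e) u
plug (fstE E) e = fst (plug E e)
plug (sndE E) e = snd (plug E e)
plug (SE E) e = S (plug E e)
plug (fE E) e = app `f (plug E e)
plug (recN₀E C E) e = recN₀ C (plug E e)
plug (recN₁E C a E) e = recN₁ C a (plug E e)
plug (recN₂E C a₀ a₁ E) e = recN₂ C a₀ a₁ (plug E e)
plug (recNE C cz g E) e = recN C cz g (plug E e)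

-- Conditions: finite partial functions ℕ ⇀ {0,1}

record Cond : Set where
  field
    at     : ℕ → Maybe Bool
    bound  : ℕ
    finite : ∀ k → bound ≤ k → at k ≡ nothing
open Cond public

_∉dom_ : ℕ → Cond → Set
m ∉dom p = at p m ≡ nothing

extend : Cond → ℕ → Bool → Cond
extend p m b = record
  { at = λ k → upd k (k Nat.≟ m)
  ; bound = bound p ⊔ suc m
  ; finite = fin
  }
  where
  open import Relation.Nullary using (Dec)
  open import Data.Nat.Properties using (m⊔n≤o⇒m≤o; m⊔n≤o⇒n≤o; <-irrefl; ≤-trans; n≤1+n)
  open import Relation.Binary.PropositionalEquality using (refl)
  open import Data.Empty using (⊥-elim)
  upd : (k : ℕ) → Dec (k ≡ m) → Maybe Bool
  upd k (yes _) = just b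
  upd k (no _)  = at p k
  fin : ∀ k → bound p ⊔ suc m ≤ k → upd k (k Nat.≟ m) ≡ nothing
  fin k le with k Nat.≟ m
  ... | yes refl = ⊥-elim (<-irrefl refl (m⊔n≤o⇒n≤o (bound p) (suc m) le))
  ... | no _ = finite p k (m⊔n≤o⇒m≤o (bound p) (suc m) le)

data _⟶[_]_ {n : ℕ} : Term n → Cond → Term n → Set where
  plain : ∀ {p e e'} → e ⟶ e' → e ⟶[ p ] e'
  oracle : ∀ {p k b} → at p k ≡ just b → app `f (num k) ⟶[ p ] bit b
  ctx   : ∀ {p e e'} (E : ECtx n) → e ⟶[ p ] e' → plug E e ⟶[ p ] plug E e'

-- A step at p(m ↦ b) either is already a step at p, or it is the oracle step
-- answering the query f m̄ with b, in which case its result is E[b] for an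
-- evaluation context E. The position of the hole in E[b] is determined by the
-- term alone (follow the evaluation spine), so E[0] = E'[1] is impossible and
-- the two steps at p(m ↦ 0) and p(m ↦ 1) cannot both be oracle steps at m.
module Submission where

open import Defs
open import Data.Nat using (ℕ)
import Data.Nat as ℕ
open import Data.Bool using (Bool; false; true)
open import Data.Maybe using (Maybe; just; nothing; _<∣>_)
open import Data.Maybe.Properties using (just-injective)
open import Data.Sum using (_⊎_; inj₁; inj₂)
open import Data.Product using (∃; _×_; _,_)
open import Relation.Binary.PropositionalEquality
open import Relation.Nullary using (yes; no)

module _ {n : ℕ} where

  _∘ᴱ_ : ECtx n → ECtx n → ECtx n
  hole ∘ᴱ F = F
  appL E u ∘ᴱ F = appL (E ∘ᴱ F) u
  fstE E ∘ᴱ F = fstE (E ∘ᴱ F)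
  sndE E ∘ᴱ F = sndE (E ∘ᴱ F)
  SE E ∘ᴱ F = SE (E ∘ᴱ F)
  fE E ∘ᴱ F = fE (E ∘ᴱ F)
  recN₀E C E ∘ᴱ F = recN₀E C (E ∘ᴱ F)
  recN₁E C a E ∘ᴱ F = recN₁E C a (E ∘ᴱ F)
  recN₂E C a₀ a₁ E ∘ᴱ F = recN₂E C a₀ a₁ (E ∘ᴱ F)
  recNE C cz g E ∘ᴱ F = recNE C cz g (E ∘ᴱ F)

  plug-∘ᴱ : ∀ E F (e : Term n) → plug (E ∘ᴱ F) e ≡ plug E (plug F e)
  plug-∘ᴱ hole F e = refl
  plug-∘ᴱ (appL E u) F e = cong (λ t → app t u) (plug-∘ᴱ E F e)
  plug-∘ᴱ (fstE E) F e = cong fst (plug-∘ᴱ E F e)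
  plug-∘ᴱ (sndE E) F e = cong snd (plug-∘ᴱ E F e)
  plug-∘ᴱ (SE E) F e = cong S (plug-∘ᴱ E F e)
  plug-∘ᴱ (fE E) F e = cong (app `f) (plug-∘ᴱ E F e)
  plug-∘ᴱ (recN₀E C E) F e = cong (recN₀ C) (plug-∘ᴱ E F e)
  plug-∘ᴱ (recN₁E C a E) F e = cong (recN₁ C a) (plug-∘ᴱ E F e)
  plug-∘ᴱ (recN₂E C a₀ a₁ E) F e = cong (recN₂ C a₀ a₁) (plug-∘ᴱ E F e)
  plug-∘ᴱ (recNE C cz g E) F e = cong (recN C cz g) (plug-∘ᴱ E F e)

  -- The first bit met along the evaluation spine. In an application the argument
  -- is reached only when the function part yields nothing, as for the context  f E.
  spineBit : Term n → Maybe Bool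
  spineBit 𝟘 = just false
  spineBit 𝟙 = just true
  spineBit (app t u) = spineBit t <∣> spineBit u
  spineBit (fst t) = spineBit t
  spineBit (snd t) = spineBit t
  spineBit (S t) = spineBit t
  spineBit (recN₀ _ e) = spineBit e
  spineBit (recN₁ _ _ e) = spineBit e
  spineBit (recN₂ _ _ _ e) = spineBit e
  spineBit (recN _ _ _ e) = spineBit e
  spineBit _ = nothing

  spineBit-plug-bit : ∀ E b → spineBit (plug E (bit b)) ≡ just b
  spineBit-plug-bit hole false = refl
  spineBit-plug-bit hole true = refl
  spineBit-plug-bit (appL E u) b = cong (_<∣> spineBit u) (spineBit-plug-bit E b)
  spineBit-plug-bit (fstE E) b = spineBit-plug-bit E b
  spineBit-plug-bit (sndE E) b = spineBit-plug-bit E b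
  spineBit-plug-bit (SE E) b = spineBit-plug-bit E b
  spineBit-plug-bit (fE E) b = spineBit-plug-bit E b
  spineBit-plug-bit (recN₀E _ E) b = spineBit-plug-bit E b
  spineBit-plug-bit (recN₁E _ _ E) b = spineBit-plug-bit E b
  spineBit-plug-bit (recN₂E _ _ _ E) b = spineBit-plug-bit E b
  spineBit-plug-bit (recNE _ _ _ E) b = spineBit-plug-bit E b

  plug-bit-injective : ∀ E E' {b b'} → plug E (bit b) ≡ plug E' (bit b') → b ≡ b'
  plug-bit-injective E E' {b} {b'} eq = just-injective (begin
    just b                      ≡⟨ sym (spineBit-plug-bit E b) ⟩
    spineBit (plug E (bit b))   ≡⟨ cong spineBit eq ⟩
    spineBit (plug E' (bit b')) ≡⟨ spineBit-plug-bit E' b' ⟩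
    just b'                     ∎)
    where open ≡-Reasoning

  OracleStepAt : ℕ → Bool → Term n → Term n → Set
  OracleStepAt m b t u = ∃ λ E → t ≡ plug E (app `f (num m)) × u ≡ plug E (bit b)

  ⟶-extend-split : ∀ p m b {t u : Term n} →
    t ⟶[ extend p m b ] u → t ⟶[ p ] u ⊎ OracleStepAt m b t u
  ⟶-extend-split p m b (plain r) = inj₁ (plain r)
  ⟶-extend-split p m b (oracle {k = k} eq) with k ℕ.≟ m
  ⟶-extend-split p m b (oracle refl) | yes refl = inj₂ (hole , refl , refl)
  ... | no _ = inj₁ (oracle eq)
  ⟶-extend-split p m b (ctx E s) with ⟶-extend-split p m b s
  ... | inj₁ r = inj₁ (ctx E r)
  ... | inj₂ (F , refl , refl) =
    inj₂ (E ∘ᴱ F , sym (plug-∘ᴱ E F _) , sym (plug-∘ᴱ E F _))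

lemma2p1 : ∀ {n} (p : Cond) (m : ℕ) (t u : Term n) →
    m ∉dom p →
    t ⟶[ extend p m false ] u →
    t ⟶[ extend p m true ] u →
    t ⟶[ p ] u
lemma2p1 p m t u _ s₀ s₁ with ⟶-extend-split p m false s₀ | ⟶-extend-split p m true s₁
... | inj₁ r | _ = r
... | inj₂ _ | inj₁ r = r
... | inj₂ (E , _ , u≡E[0]) | inj₂ (E' , _ , u≡E'[1])
  with () ← plug-bit-injective E E' (trans (sym u≡E[0]) u≡E'[1])
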